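{- Let $m\geq 3$ be an integer, let $k$ be an integer with $3\leq k\leq 2^m-4$, and let $\alpha\in\mathbb{F}_{2^m}\setminus\{0\}$. Define $$I_k^\alpha=\{B\subseteq \mathbb{F}_{2^m}\setminus\{0,\alpha\} : |B|=k,\ \textstyle\sum_{x\in B}x=\alpha\},\qquad J_k^\alpha=\{B\subseteq \mathbb{F}_{2^m}\setminus\{0,\alpha\} : |B|=k,\ \textstyle\sum_{x\in B}x=0\}.$$ Then $$|I_k^\alpha|=\begin{cases} |J_k^\alpha|, & k\equiv 1,3 \pmod 4,\\ |J_k^\alpha|+\binom{2^{m-1}-1}{k/2}, & k\equiv 2\pmod 4,\\ |J_k^\alpha|-\binom{2^{m-1}-1}{k/2}, & k\equiv 0\pmod 4.\end{cases}$$
   Context: $\mathbb{F}_{2^m}$ denotes the finite field with $2^m$ elements. -}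

module Defs where

open import Data.Bool using (Bool; true; false; _xor_; _∧_; not)
open import Data.Bool.Properties using () renaming (_≟_ to _≟B_)
open import Data.Nat using (ℕ; zero; suc; _≡ᵇ_)
open import Data.List using (List; []; _∷_; [_]; _++_; map; foldr; length; filterᵇ)
open import Data.Vec using (Vec; replicate; zipWith)
open import Data.Vec.Properties using (≡-dec)
open import Relation.Nullary.Decidable using (⌊_⌋)

-- The additive group of F_{2^m}, identified with F_2^m (bit vectors, addition = xor).
F : ℕ → Set
F m = Vec Bool m

0F : ∀ {m} → F m
0F {m} = replicate m false

_⊕_ : ∀ {m} → F m → F m → F m
_⊕_ = zipWith _xor_

_==_ : ∀ {m} → F m → F m → Bool
x == y = ⌊ ≡-dec _≟B_ x y ⌋

allF : (m : ℕ) → List (F m)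
allF zero = [ Data.Vec.[] ]
allF (suc m) = map (false Data.Vec.∷_) (allF m) ++ map (true Data.Vec.∷_) (allF m)

-- all sub-lists (= subsets, when the input list has no duplicates)
subsets : ∀ {A : Set} → List A → List (List A)
subsets [] = [ [] ]
subsets (x ∷ xs) = subsets xs ++ map (x ∷_) (subsets xs)

sumF : ∀ {m} → List (F m) → F m
sumF = foldr _⊕_ 0F

ground : ∀ {m} → F m → List (F m)
ground {m} α = filterᵇ (λ x → not (x == 0F) ∧ not (x == α)) (allF m)

countSum : ∀ {m} → ℕ → F m → F m → ℕ
countSum k α s = length (filterᵇ (λ B → (length B ≡ᵇ k) ∧ (sumF B == s)) (subsets (ground α)))

cardI : ∀ {m} → ℕ → F m → ℕ
cardI k α = countSum k α α

cardJ : ∀ {m} → ℕ → F m → ℕ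
cardJ k α = countSum k α 0F

{-# OPTIONS --safe #-}
-- The map x ↦ x + α is a fixed-point-free involution of F_{2^m} ∖ {0, α}, so this set is a
-- disjoint union of N = 2^{m-1} - 1 pairs {x, x + α}.  Write c_k(s) for the number of k-subsets
-- with sum s of a union of such pairs.  Adding one more pair multiplies the series
-- ∑_k (c_k(0) - c_k(α)) t^k by 1 - t²: subsets meeting the new pair in one point contribute
-- equally to both sums (the two choices differ by α), while subsets containing the whole pair
-- gain two elements and have the sums 0 and α exchanged.  Hence |J_k| - |I_k| is the
-- coefficient of t^k in (1 - t²)^N, which is 0 for odd k and (-1)^{k/2} C(N, k/2) for even k.
module Submission where

open import Defs
open import Data.Nat using (ℕ; _+_; _∸_; _^_; _≤_)
open import Data.Nat.DivMod using (_%_; _/_)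
open import Data.Nat.Combinatorics using (_C_)
open import Data.Product using (_×_)
open import Data.Sum using (_⊎_)
open import Relation.Binary.PropositionalEquality using (_≡_; _≢_)

open import Data.Bool using (Bool; true; false; _∧_; not; T)
open import Data.Bool.Properties
  using (xor-comm; xor-assoc; xor-identityˡ; xor-identityʳ; xor-same; T-∧) renaming (_≟_ to _≟ᴮ_)
open import Data.Integer using (ℤ; +_; -_; _-_; 0ℤ; 1ℤ; -1ℤ)
  renaming (_+_ to _+ℤ_; _*_ to _*ℤ_; _^_ to _^ℤ_)
import Data.Integer.Properties as ℤ
open import Data.Integer.Tactic.RingSolver using (solve-∀)
open import Data.List using (List; []; _∷_; _++_; map; length; filter; filterᵇ)
open import Data.List.Membership.Propositional using (_∈_; _∉_)
open import Data.List.Membership.Propositional.Properties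
  using (∈-∃++; ∈-map⁺; ∈-map⁻; ∈-++⁺ˡ; ∈-++⁺ʳ; ∈-filter⁺; ∈-filter⁻)
open import Data.List.Properties
  using (filter-++; filter-≐; filter-none; filter-accept; filter-reject; filter-all; length-++; length-map)
open import Data.List.Relation.Binary.Permutation.Propositional as ↭
  using (_↭_; prep; swap; ↭-sym; ↭-reflexive; ↭⇒↭ₛ)
open import Data.List.Relation.Binary.Permutation.Propositional.Properties
  using (shift; ∈-resp-↭; ↭-length; filter-↭)
import Data.List.Relation.Binary.Permutation.Setoid.Properties as PermutationSetoid
open import Data.List.Relation.Unary.All using ([]; universal; tabulate)
open import Data.List.Relation.Unary.AllPairs using ([]; _∷_) renaming (tail to Unique-tail)
open import Data.List.Relation.Unary.Any using (here; there)
open import Data.List.Relation.Unary.Unique.Propositional using (Unique)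
import Data.List.Relation.Unary.Unique.Propositional.Properties as Unique
open import Data.Nat using (zero; suc; _*_; _≡ᵇ_; s≤s)
open import Data.Nat.Combinatorics using (nCk+nC[k+1]≡[n+1]C[k+1])
open import Data.Nat.DivMod using (m≡m%n+[m/n]*n; m*n/n≡m)
open import Data.Nat.Properties
  using (+-identityʳ; *-suc; *-comm; *-cancelˡ-≡; ≤-refl; ≤-trans; n≤1+n; +-commutativeSemigroup)
open import Algebra.Properties.CommutativeSemigroup +-commutativeSemigroup using (xy∙z≈xz∙y; interchange)
open import Data.Nat.Tactic.RingSolver using () renaming (solve-∀ to ℕ-solve-∀)
import Data.Product as Product
open import Data.Product using (_,_; proj₁; proj₂; ∃-syntax)
open import Data.Sum using (inj₁; inj₂)
open import Data.Vec using ([]; _∷_)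
open import Data.Vec.Properties
  using (≡-dec; ∷-injectiveʳ; zipWith-comm; zipWith-assoc; zipWith-identityˡ; zipWith-identityʳ)
open import Function using (_∘_; _⇔_; mk⇔; module Equivalence)
open import Relation.Binary.Definitions using (DecidableEquality)
open import Relation.Binary.PropositionalEquality
  using (refl; sym; trans; cong; cong₂; subst; _≗_; setoid; module ≡-Reasoning)
open import Relation.Nullary using (¬_; contradiction)
open import Relation.Nullary.Decidable
  using (T?; isYes; does; isYes≗does; does-⇔; toWitness; fromWitness; toWitnessFalse; fromWitnessFalse)

_≟_ : ∀ {m} → DecidableEquality (F m)
_≟_ = ≡-dec _≟ᴮ_

⊕-comm : ∀ {m} (x y : F m) → x ⊕ y ≡ y ⊕ x
⊕-comm = zipWith-comm xor-comm

⊕-assoc : ∀ {m} (x y z : F m) → (x ⊕ y) ⊕ z ≡ x ⊕ (y ⊕ z)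
⊕-assoc = zipWith-assoc xor-assoc

⊕-identityˡ : ∀ {m} (x : F m) → 0F ⊕ x ≡ x
⊕-identityˡ = zipWith-identityˡ xor-identityˡ

⊕-identityʳ : ∀ {m} (x : F m) → x ⊕ 0F ≡ x
⊕-identityʳ = zipWith-identityʳ xor-identityʳ

⊕-self : ∀ {m} (x : F m) → x ⊕ x ≡ 0F
⊕-self [] = refl
⊕-self (b ∷ x) = cong₂ _∷_ (xor-same b) (⊕-self x)

⊕-cancelˡ : ∀ {m} (x y : F m) → x ⊕ (x ⊕ y) ≡ y
⊕-cancelˡ x y = begin
  x ⊕ (x ⊕ y) ≡⟨ sym (⊕-assoc x x y) ⟩
  (x ⊕ x) ⊕ y ≡⟨ cong (_⊕ y) (⊕-self x) ⟩
  0F ⊕ y      ≡⟨ ⊕-identityˡ y ⟩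
  y           ∎
  where open ≡-Reasoning

⊕-cancelʳ : ∀ {m} (x y : F m) → (x ⊕ y) ⊕ y ≡ x
⊕-cancelʳ x y = begin
  (x ⊕ y) ⊕ y ≡⟨ ⊕-assoc x y y ⟩
  x ⊕ (y ⊕ y) ≡⟨ cong (x ⊕_) (⊕-self y) ⟩
  x ⊕ 0F      ≡⟨ ⊕-identityʳ x ⟩
  x           ∎
  where open ≡-Reasoning

[x⊕y]⊕x≡y : ∀ {m} (x y : F m) → (x ⊕ y) ⊕ x ≡ y
[x⊕y]⊕x≡y x y = trans (cong (_⊕ x) (⊕-comm x y)) (⊕-cancelʳ y x)

x⊕y≡x⇒y≡0 : ∀ {m} {x y : F m} → x ⊕ y ≡ x → y ≡ 0F
x⊕y≡x⇒y≡0 {x = x} {y} x⊕y≡x = begin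
  y           ≡⟨ ⊕-cancelˡ x y ⟨
  x ⊕ (x ⊕ y) ≡⟨ cong (x ⊕_) x⊕y≡x ⟩
  x ⊕ x       ≡⟨ ⊕-self x ⟩
  0F          ∎
  where open ≡-Reasoning

x⊕yz≡y⊕xz : ∀ {m} (x y z : F m) → x ⊕ (y ⊕ z) ≡ y ⊕ (x ⊕ z)
x⊕yz≡y⊕xz x y z = begin
  x ⊕ (y ⊕ z) ≡⟨ sym (⊕-assoc x y z) ⟩
  (x ⊕ y) ⊕ z ≡⟨ cong (_⊕ z) (⊕-comm x y) ⟩
  (y ⊕ x) ⊕ z ≡⟨ ⊕-assoc y x z ⟩
  y ⊕ (x ⊕ z) ∎
  where open ≡-Reasoning

==-⇔ : ∀ {m} {x y u v : F m} → x ≡ y ⇔ u ≡ v → (x == y) ≡ (u == v)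
==-⇔ {x = x} {y} {u} {v} x≡y⇔u≡v = begin
  isYes (x ≟ y) ≡⟨ isYes≗does (x ≟ y) ⟩
  does (x ≟ y)  ≡⟨ does-⇔ x≡y⇔u≡v (x ≟ y) (u ≟ v) ⟩
  does (u ≟ v)  ≡⟨ isYes≗does (u ≟ v) ⟨
  isYes (u ≟ v) ∎
  where open ≡-Reasoning

⊕-==-shift : ∀ {m} (x y s : F m) → ((x ⊕ y) == s) ≡ (y == (x ⊕ s))
⊕-==-shift x y s = ==-⇔ (mk⇔ (λ x⊕y≡s → trans (sym (⊕-cancelˡ x y)) (cong (x ⊕_) x⊕y≡s))
                             (λ y≡x⊕s → trans (cong (x ⊕_) y≡x⊕s) (⊕-cancelˡ x s)))

length-filterᵇ-map : ∀ {A B : Set} (p : B → Bool) (g : A → B) (xs : List A) →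
                     length (filterᵇ p (map g xs)) ≡ length (filterᵇ (p ∘ g) xs)
length-filterᵇ-map p g [] = refl
length-filterᵇ-map p g (x ∷ xs) with p (g x)
... | true  = cong suc (length-filterᵇ-map p g xs)
... | false = length-filterᵇ-map p g xs

filterᵇ-cong : ∀ {A : Set} {p q : A → Bool} → (∀ x → p x ≡ q x) →
               ∀ xs → filterᵇ p xs ≡ filterᵇ q xs
filterᵇ-cong p≗q = filter-≐ _ _ ((λ {x} → subst T (p≗q x)) , λ {x} → subst T (sym (p≗q x)))

length-filterᵇ-++-map : ∀ {A B : Set} (p : B → Bool) (g : A → B) (xs : List B) (ys : List A) →
  length (filterᵇ p (xs ++ map g ys)) ≡ length (filterᵇ p xs) + length (filterᵇ (p ∘ g) ys)
length-filterᵇ-++-map p g xs ys = begin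
  length (filterᵇ p (xs ++ map g ys))
    ≡⟨ cong length (filter-++ (T? ∘ p) xs (map g ys)) ⟩
  length (filterᵇ p xs ++ filterᵇ p (map g ys))
    ≡⟨ length-++ (filterᵇ p xs) ⟩
  length (filterᵇ p xs) + length (filterᵇ p (map g ys))
    ≡⟨ cong (λ n → length (filterᵇ p xs) + n) (length-filterᵇ-map p g ys) ⟩
  length (filterᵇ p xs) + length (filterᵇ (p ∘ g) ys) ∎
  where open ≡-Reasoning

∈⇒↭∷ : ∀ {A : Set} {y : A} {L} → y ∈ L → ∃[ R ] L ↭ y ∷ R
∈⇒↭∷ {y = y} y∈L with us , vs , refl ← ∈-∃++ y∈L = us ++ vs , shift y us vs

∈⇒↭∷∷ : ∀ {A : Set} {x y : A} {L} → x ∈ L → y ∈ L → x ≢ y → ∃[ R ] L ↭ x ∷ y ∷ R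
∈⇒↭∷∷ {x = x} x∈L y∈L x≢y with R₁ , L↭xR₁ ← ∈⇒↭∷ x∈L with ∈-resp-↭ L↭xR₁ y∈L
... | here y≡x    = contradiction (sym y≡x) x≢y
... | there y∈R₁ with R , R₁↭yR ← ∈⇒↭∷ y∈R₁ = R , ↭.trans L↭xR₁ (prep x R₁↭yR)

Unique-resp-↭ : ∀ {A : Set} {L L′ : List A} → L ↭ L′ → Unique L → Unique L′
Unique-resp-↭ {A} L↭L′ = PermutationSetoid.Unique-resp-↭ (setoid A) (↭⇒↭ₛ L↭L′)

pairs : ∀ {A : Set} → (A → A) → List A → List A
pairs f []       = []
pairs f (x ∷ xs) = x ∷ f x ∷ pairs f xs

length-pairs : ∀ {A : Set} (f : A → A) xs → length (pairs f xs) ≡ 2 * length xs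
length-pairs f []       = refl
length-pairs f (x ∷ xs) = trans (cong (λ n → 2 + n) (length-pairs f xs)) (sym (*-suc 2 (length xs)))

↭-pairs : ∀ {A : Set} {f : A → A} → (∀ x → f (f x) ≡ x) → (∀ x → f x ≢ x) →
          ∀ {L} → Unique L → (∀ {y} → y ∈ L → f y ∈ L) → ∃[ xs ] L ↭ pairs f xs
↭-pairs {f = f} involutive fixpoint-free {L} = go (length L) ≤-refl
  where
  fy≡x⇒y≡fx : ∀ {x y} → f y ≡ x → y ≡ f x
  fy≡x⇒y≡fx {y = y} fy≡x = trans (sym (involutive y)) (cong f fy≡x)
  go : ∀ n {L} → length L ≤ n → Unique L → (∀ {y} → y ∈ L → f y ∈ L) → ∃[ xs ] L ↭ pairs f xs
  go _ {[]} _ _ _ = [] , ↭.refl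
  go (suc n) {x ∷ L} (s≤s |L|≤n) unique closed with closed (here refl)
  ... | here fx≡x = contradiction fx≡x (fixpoint-free x)
  ... | there fx∈L with R , L↭fx∷R ← ∈⇒↭∷ fx∈L =
    x ∷ proj₁ pairingR , ↭.trans x∷L↭x∷fx∷R (prep x (prep (f x) (proj₂ pairingR)))
    where
    x∷L↭x∷fx∷R : x ∷ L ↭ x ∷ f x ∷ R
    x∷L↭x∷fx∷R = prep x L↭fx∷R
    unique′ : Unique (x ∷ f x ∷ R)
    unique′ = Unique-resp-↭ x∷L↭x∷fx∷R unique
    x∉R : x ∉ R
    x∉R x∈R = Unique.Unique[x∷xs]⇒x∉xs unique′ (there x∈R)
    fx∉R : f x ∉ R
    fx∉R = Unique.Unique[x∷xs]⇒x∉xs (Unique-tail unique′)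
    closedR : ∀ {y} → y ∈ R → f y ∈ R
    closedR {y} y∈R
      with ∈-resp-↭ x∷L↭x∷fx∷R (closed (∈-resp-↭ (↭-sym x∷L↭x∷fx∷R) (there (there y∈R))))
    ... | here fy≡x          = contradiction (subst (_∈ R) (fy≡x⇒y≡fx fy≡x) y∈R) fx∉R
    ... | there (here fy≡fx) = contradiction (subst (_∈ R) (trans (fy≡x⇒y≡fx fy≡fx) (involutive x)) y∈R) x∉R
    ... | there (there fy∈R) = fy∈R
    |R|≤n : length R ≤ n
    |R|≤n = ≤-trans (n≤1+n (length R)) (subst (_≤ n) (↭-length L↭fx∷R) |L|≤n)
    pairingR : ∃[ xs ] R ↭ pairs f xs
    pairingR = go n |R|≤n (Unique-tail (Unique-tail unique′)) closedR

Counts : ℕ → Set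
Counts m = ℕ → F m → ℕ

_≋_ : ∀ {m} → Counts m → Counts m → Set
c ≋ d = ∀ k s → c k s ≡ d k s

hasSizeAndSum : ∀ {m} → ℕ → F m → List (F m) → Bool
hasSizeAndSum k s B = (length B ≡ᵇ k) ∧ (sumF B == s)

countSubsets : ∀ {m} → List (F m) → Counts m
countSubsets L k s = length (filterᵇ (hasSizeAndSum k s) (subsets L))

adjoin : ∀ {m} → F m → Counts m → Counts m
adjoin x c zero    s = c zero s
adjoin x c (suc k) s = c (suc k) s + c k (x ⊕ s)

countSubsets-∷ : ∀ {m} (x : F m) L → countSubsets (x ∷ L) ≋ adjoin x (countSubsets L)
countSubsets-∷ x L k s =
  trans (length-filterᵇ-++-map (hasSizeAndSum k s) (x ∷_) (subsets L) (subsets L)) (with-x k)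
  where
  with-x : ∀ k → countSubsets L k s + length (filterᵇ (hasSizeAndSum k s ∘ (x ∷_)) (subsets L))
               ≡ adjoin x (countSubsets L) k s
  with-x zero = trans
    (cong (λ Bs → countSubsets L zero s + length Bs)
          (filter-none (T? ∘ hasSizeAndSum zero s ∘ (x ∷_)) (universal (λ _ ()) (subsets L))))
    (+-identityʳ (countSubsets L zero s))
  with-x (suc k) = cong (λ Bs → countSubsets L (suc k) s + length Bs)
    (filterᵇ-cong (λ B → cong ((length B ≡ᵇ k) ∧_) (⊕-==-shift x (sumF B) s)) (subsets L))

adjoin-cong : ∀ {m} (x : F m) {c d} → c ≋ d → adjoin x c ≋ adjoin x d
adjoin-cong x c≋d zero    s = c≋d zero s
adjoin-cong x c≋d (suc k) s = cong₂ _+_ (c≋d (suc k) s) (c≋d k (x ⊕ s))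

adjoin-comm : ∀ {m} (x y : F m) c → adjoin x (adjoin y c) ≋ adjoin y (adjoin x c)
adjoin-comm x y c zero          s = refl
adjoin-comm x y c (suc zero)    s = xy∙z≈xz∙y (c 1 s) (c 0 (y ⊕ s)) (c 0 (x ⊕ s))
adjoin-comm x y c (suc (suc k)) s
  rewrite x⊕yz≡y⊕xz y x s =
    interchange (c (2 + k) s) (c (1 + k) (y ⊕ s)) (c (1 + k) (x ⊕ s)) (c k (x ⊕ (y ⊕ s)))

countSubsets-↭ : ∀ {m} {L L′ : List (F m)} → L ↭ L′ → countSubsets L ≋ countSubsets L′
countSubsets-↭ ↭.refl k s = refl
countSubsets-↭ {L = x ∷ L} {x ∷ L′} (prep x L↭L′) k s = begin
  countSubsets (x ∷ L) k s         ≡⟨ countSubsets-∷ x L k s ⟩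
  adjoin x (countSubsets L) k s    ≡⟨ adjoin-cong x (countSubsets-↭ L↭L′) k s ⟩
  adjoin x (countSubsets L′) k s   ≡⟨ countSubsets-∷ x L′ k s ⟨
  countSubsets (x ∷ L′) k s        ∎
  where open ≡-Reasoning
countSubsets-↭ {L = x ∷ y ∷ L} {y ∷ x ∷ L′} (swap x y L↭L′) k s = begin
  countSubsets (x ∷ y ∷ L) k s
    ≡⟨ countSubsets-∷ x (y ∷ L) k s ⟩
  adjoin x (countSubsets (y ∷ L)) k s
    ≡⟨ adjoin-cong x (λ k s → trans (countSubsets-∷ y L k s)
                                    (adjoin-cong y (countSubsets-↭ L↭L′) k s)) k s ⟩
  adjoin x (adjoin y (countSubsets L′)) k s
    ≡⟨ adjoin-comm x y (countSubsets L′) k s ⟩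
  adjoin y (adjoin x (countSubsets L′)) k s
    ≡⟨ adjoin-cong y (λ k s → countSubsets-∷ x L′ k s) k s ⟨
  adjoin y (countSubsets (x ∷ L′)) k s
    ≡⟨ countSubsets-∷ y (x ∷ L′) k s ⟨
  countSubsets (y ∷ x ∷ L′) k s ∎
  where open ≡-Reasoning
countSubsets-↭ (↭.trans L↭L′ L′↭L″) k s =
  trans (countSubsets-↭ L↭L′ k s) (countSubsets-↭ L′↭L″ k s)

-- a sequence f : ℕ → ℤ stands for the power series ∑ₖ f k tᵏ
times[1-t²] : (ℕ → ℤ) → ℕ → ℤ
times[1-t²] f zero          = f zero
times[1-t²] f (suc zero)    = f 1
times[1-t²] f (suc (suc k)) = f (2 + k) - f k

[1-t²]^ : ℕ → ℕ → ℤ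
[1-t²]^ zero    zero    = 1ℤ
[1-t²]^ zero    (suc k) = 0ℤ
[1-t²]^ (suc N)         = times[1-t²] ([1-t²]^ N)

times[1-t²]-cong : ∀ {f g : ℕ → ℤ} → f ≗ g → times[1-t²] f ≗ times[1-t²] g
times[1-t²]-cong f≗g zero          = f≗g 0
times[1-t²]-cong f≗g (suc zero)    = f≗g 1
times[1-t²]-cong f≗g (suc (suc k)) = cong₂ _-_ (f≗g (2 + k)) (f≗g k)

[1-t²]^-odd : ∀ N j → [1-t²]^ N (1 + 2 * j) ≡ 0ℤ
[1-t²]^-odd zero    j       = refl
[1-t²]^-odd (suc N) zero    = [1-t²]^-odd N zero
[1-t²]^-odd (suc N) (suc j) = begin
  [1-t²]^ (suc N) (1 + 2 * suc j)                     ≡⟨ cong (λ i → [1-t²]^ (suc N) (1 + i)) (*-suc 2 j) ⟩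
  [1-t²]^ N (1 + (2 + 2 * j)) - [1-t²]^ N (1 + 2 * j) ≡⟨ cong₂ _-_ odd[1+j] ([1-t²]^-odd N j) ⟩
  0ℤ - 0ℤ                                             ∎
  where
  open ≡-Reasoning
  odd[1+j] : [1-t²]^ N (1 + (2 + 2 * j)) ≡ 0ℤ
  odd[1+j] = trans (cong (λ i → [1-t²]^ N (1 + i)) (sym (*-suc 2 j))) ([1-t²]^-odd N (suc j))

[1-t²]^-even : ∀ N j → [1-t²]^ N (2 * j) ≡ -1ℤ ^ℤ j *ℤ + (N C j)
[1-t²]^-even zero    zero    = refl
[1-t²]^-even zero    (suc j) = sym (ℤ.*-zeroʳ (-1ℤ ^ℤ suc j))
[1-t²]^-even (suc N) zero    = [1-t²]^-even N zero
[1-t²]^-even (suc N) (suc j) = begin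
  [1-t²]^ (suc N) (2 * suc j)
    ≡⟨ cong ([1-t²]^ (suc N)) (*-suc 2 j) ⟩
  [1-t²]^ N (2 + 2 * j) - [1-t²]^ N (2 * j)
    ≡⟨ cong₂ _-_ even[1+j] ([1-t²]^-even N j) ⟩
  -1ℤ *ℤ s *ℤ + (N C suc j) - s *ℤ + (N C j)
    ≡⟨ pascal-step s (+ (N C suc j)) (+ (N C j)) ⟩
  -1ℤ *ℤ s *ℤ (+ (N C j) +ℤ + (N C suc j))
    ≡⟨ cong (λ b → -1ℤ *ℤ s *ℤ b) (ℤ.pos-+ (N C j) (N C suc j)) ⟨
  -1ℤ *ℤ s *ℤ + (N C j + N C suc j)
    ≡⟨ cong (λ b → -1ℤ *ℤ s *ℤ + b) (nCk+nC[k+1]≡[n+1]C[k+1] N j) ⟩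
  -1ℤ ^ℤ suc j *ℤ + (suc N C suc j) ∎
  where
  open ≡-Reasoning
  s = -1ℤ ^ℤ j
  even[1+j] : [1-t²]^ N (2 + 2 * j) ≡ -1ℤ ^ℤ suc j *ℤ + (N C suc j)
  even[1+j] = trans (cong ([1-t²]^ N) (sym (*-suc 2 j))) ([1-t²]^-even N (suc j))
  pascal-step : ∀ s a b → -1ℤ *ℤ s *ℤ a - s *ℤ b ≡ -1ℤ *ℤ s *ℤ (b +ℤ a)
  pascal-step = solve-∀

-1^[2n]≡1 : ∀ n → -1ℤ ^ℤ (2 * n) ≡ 1ℤ
-1^[2n]≡1 n = trans (sym (ℤ.^-*-assoc -1ℤ 2 n)) (ℤ.^-zeroˡ n)

[1-t²]^-at-even : ∀ N {k} j → k ≡ 2 * j → [1-t²]^ N k ≡ -1ℤ ^ℤ j *ℤ + (N C (k / 2))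
[1-t²]^-at-even N j refl = begin
  [1-t²]^ N (2 * j)                    ≡⟨ [1-t²]^-even N j ⟩
  -1ℤ ^ℤ j *ℤ + (N C j)                ≡⟨ cong (λ i → -1ℤ ^ℤ j *ℤ + (N C i)) [2j]/2≡j ⟨
  -1ℤ ^ℤ j *ℤ + (N C (2 * j / 2))      ∎
  where
  open ≡-Reasoning
  [2j]/2≡j : 2 * j / 2 ≡ j
  [2j]/2≡j = trans (cong (_/ 2) (*-comm 2 j)) (m*n/n≡m j 2)

[1-t²]^-mod4 : ∀ N k →
    ((k % 4 ≡ 1 ⊎ k % 4 ≡ 3) → [1-t²]^ N k ≡ 0ℤ)
  × (k % 4 ≡ 2 → [1-t²]^ N k ≡ - + (N C (k / 2)))
  × (k % 4 ≡ 0 → [1-t²]^ N k ≡ + (N C (k / 2)))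
[1-t²]^-mod4 N k = odd , twoMod4 , zeroMod4
  where
  open ≡-Reasoning
  q = k / 4
  k≡r+q*4 : ∀ {r} → k % 4 ≡ r → k ≡ r + q * 4
  k≡r+q*4 k%4≡r = trans (m≡m%n+[m/n]*n k 4) (cong (_+ q * 4) k%4≡r)
  q*4≡2[2q] : ∀ q → q * 4 ≡ 2 * (2 * q)
  q*4≡2[2q] = ℕ-solve-∀
  1+q*4≡1+2[2q] : ∀ q → 1 + q * 4 ≡ 1 + 2 * (2 * q)
  1+q*4≡1+2[2q] = ℕ-solve-∀
  2+q*4≡2[1+2q] : ∀ q → 2 + q * 4 ≡ 2 * (1 + 2 * q)
  2+q*4≡2[1+2q] = ℕ-solve-∀
  3+q*4≡1+2[1+2q] : ∀ q → 3 + q * 4 ≡ 1 + 2 * (1 + 2 * q)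
  3+q*4≡1+2[1+2q] = ℕ-solve-∀
  odd : (k % 4 ≡ 1 ⊎ k % 4 ≡ 3) → [1-t²]^ N k ≡ 0ℤ
  odd (inj₁ k%4≡1) =
    trans (cong ([1-t²]^ N) (trans (k≡r+q*4 k%4≡1) (1+q*4≡1+2[2q] q))) ([1-t²]^-odd N (2 * q))
  odd (inj₂ k%4≡3) =
    trans (cong ([1-t²]^ N) (trans (k≡r+q*4 k%4≡3) (3+q*4≡1+2[1+2q] q))) ([1-t²]^-odd N (1 + 2 * q))
  twoMod4 : k % 4 ≡ 2 → [1-t²]^ N k ≡ - + (N C (k / 2))
  twoMod4 k%4≡2 = begin
    [1-t²]^ N k
      ≡⟨ [1-t²]^-at-even N (1 + 2 * q) (trans (k≡r+q*4 k%4≡2) (2+q*4≡2[1+2q] q)) ⟩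
    -1ℤ *ℤ -1ℤ ^ℤ (2 * q) *ℤ + (N C (k / 2))
      ≡⟨ cong (λ s → -1ℤ *ℤ s *ℤ + (N C (k / 2))) (-1^[2n]≡1 q) ⟩
    -1ℤ *ℤ + (N C (k / 2))
      ≡⟨ ℤ.-1*i≡-i (+ (N C (k / 2))) ⟩
    - + (N C (k / 2)) ∎
  zeroMod4 : k % 4 ≡ 0 → [1-t²]^ N k ≡ + (N C (k / 2))
  zeroMod4 k%4≡0 = begin
    [1-t²]^ N k
      ≡⟨ [1-t²]^-at-even N (2 * q) (trans (k≡r+q*4 k%4≡0) (q*4≡2[2q] q)) ⟩
    -1ℤ ^ℤ (2 * q) *ℤ + (N C (k / 2))
      ≡⟨ cong (λ s → s *ℤ + (N C (k / 2))) (-1^[2n]≡1 q) ⟩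
    1ℤ *ℤ + (N C (k / 2))
      ≡⟨ ℤ.*-identityˡ (+ (N C (k / 2))) ⟩
    + (N C (k / 2)) ∎

+[a+p+q]-+[b+q+p]≡+a-+b : ∀ a b p q → + (a + p + q) - + (b + q + p) ≡ + a - + b
+[a+p+q]-+[b+q+p]≡+a-+b a b p q
  rewrite ℤ.pos-+ (a + p) q | ℤ.pos-+ a p | ℤ.pos-+ (b + q) p | ℤ.pos-+ b q
  = cancel (+ a) (+ b) (+ p) (+ q)
  where
  cancel : ∀ a b p q → a +ℤ p +ℤ q - (b +ℤ q +ℤ p) ≡ a - b
  cancel = solve-∀

+[a+p+[q+d]]-+[b+q+[p+e]]≡[+a-+b]-[+e-+d] : ∀ a b p q d e →
  + (a + p + (q + d)) - + (b + q + (p + e)) ≡ (+ a - + b) - (+ e - + d)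
+[a+p+[q+d]]-+[b+q+[p+e]]≡[+a-+b]-[+e-+d] a b p q d e
  rewrite ℤ.pos-+ (a + p) (q + d) | ℤ.pos-+ a p | ℤ.pos-+ q d
        | ℤ.pos-+ (b + q) (p + e) | ℤ.pos-+ b q | ℤ.pos-+ p e
  = cancel (+ a) (+ b) (+ p) (+ q) (+ d) (+ e)
  where
  cancel : ∀ a b p q d e → a +ℤ p +ℤ (q +ℤ d) - (b +ℤ q +ℤ (p +ℤ e)) ≡ (a - b) - (e - d)
  cancel = solve-∀

imbalance : ∀ {m} → F m → Counts m → ℕ → ℤ
imbalance α c k = + c k 0F - + c k α

imbalance-cong : ∀ {m} (α : F m) {c d} → c ≋ d → imbalance α c ≗ imbalance α d
imbalance-cong α c≋d k = cong₂ (λ a b → + a - + b) (c≋d k 0F) (c≋d k α)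

imbalance-adjoinPair : ∀ {m} (α x : F m) c →
  imbalance α (adjoin x (adjoin (x ⊕ α) c)) ≗ times[1-t²] (imbalance α c)
imbalance-adjoinPair α x c zero = refl
imbalance-adjoinPair α x c (suc zero)
  rewrite ⊕-identityʳ (x ⊕ α) | ⊕-identityʳ x | ⊕-cancelʳ x α
  = +[a+p+q]-+[b+q+p]≡+a-+b (c 1 0F) (c 1 α) (c 0 (x ⊕ α)) (c 0 x)
imbalance-adjoinPair α x c (suc (suc k))
  rewrite ⊕-identityʳ (x ⊕ α) | ⊕-identityʳ x | ⊕-cancelʳ x α | ⊕-self (x ⊕ α) | [x⊕y]⊕x≡y x α
  = +[a+p+[q+d]]-+[b+q+[p+e]]≡[+a-+b]-[+e-+d]
      (c (2 + k) 0F) (c (2 + k) α) (c (1 + k) (x ⊕ α)) (c (1 + k) x) (c k α) (c k 0F)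

imbalance-[] : ∀ {m} {α : F m} → α ≢ 0F → imbalance α (countSubsets []) ≗ [1-t²]^ 0
imbalance-[] {m} {α} α≢0 zero = cong₂ (λ a b → + a - + b)
  (cong length (filter-accept (T? ∘ hasSizeAndSum 0 (0F {m})) {x = []} {xs = []}
                              (fromWitness {a? = 0F {m} ≟ 0F} refl)))
  (cong length (filter-reject (T? ∘ hasSizeAndSum 0 α) {x = []} {xs = []}
                              (α≢0 ∘ sym ∘ toWitness {a? = 0F ≟ α})))
imbalance-[] α≢0 (suc k) = refl

imbalance-pairs : ∀ {m} {α : F m} → α ≢ 0F → ∀ xs →
  imbalance α (countSubsets (pairs (_⊕ α) xs)) ≗ [1-t²]^ (length xs)
imbalance-pairs α≢0 [] = imbalance-[] α≢0
imbalance-pairs {α = α} α≢0 (x ∷ xs) k = begin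
  imbalance α (countSubsets (x ∷ (x ⊕ α) ∷ L)) k         ≡⟨ imbalance-cong α adjoined k ⟩
  imbalance α (adjoin x (adjoin (x ⊕ α) (countSubsets L))) k ≡⟨ imbalance-adjoinPair α x (countSubsets L) k ⟩
  times[1-t²] (imbalance α (countSubsets L)) k           ≡⟨ times[1-t²]-cong (imbalance-pairs α≢0 xs) k ⟩
  times[1-t²] ([1-t²]^ (length xs)) k                    ∎
  where
  open ≡-Reasoning
  L = pairs (_⊕ α) xs
  adjoined : countSubsets (x ∷ (x ⊕ α) ∷ L) ≋ adjoin x (adjoin (x ⊕ α) (countSubsets L))
  adjoined k s = trans (countSubsets-∷ x ((x ⊕ α) ∷ L) k s) (adjoin-cong x (countSubsets-∷ (x ⊕ α) L) k s)

∈-allF : ∀ {m} (y : F m) → y ∈ allF m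
∈-allF []          = here refl
∈-allF (false ∷ y) = ∈-++⁺ˡ (∈-map⁺ (false ∷_) (∈-allF y))
∈-allF (true  ∷ y) = ∈-++⁺ʳ (map (false ∷_) (allF _)) (∈-map⁺ (true ∷_) (∈-allF y))

allF-unique : ∀ m → Unique (allF m)
allF-unique zero    = [] ∷ []
allF-unique (suc m) = Unique.++⁺ (halfUnique false) (halfUnique true) disjoint
  where
  halfUnique : ∀ b → Unique (map (b ∷_) (allF m))
  halfUnique b = Unique.map⁺ ∷-injectiveʳ (allF-unique m)
  disjoint : ∀ {v} → ¬ (v ∈ map (false ∷_) (allF m) × v ∈ map (true ∷_) (allF m))
  disjoint (v∈false , v∈true) with _ , _ , refl ← ∈-map⁻ (false ∷_) v∈false
                                 | _ , _ , ()   ← ∈-map⁻ (true ∷_) v∈true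

length-allF : ∀ m → length (allF m) ≡ 2 ^ m
length-allF zero    = refl
length-allF (suc m) = begin
  length (map (false ∷_) (allF m) ++ map (true ∷_) (allF m))
    ≡⟨ length-++ (map (false ∷_) (allF m)) ⟩
  length (map (false ∷_) (allF m)) + length (map (true ∷_) (allF m))
    ≡⟨ cong₂ _+_ (length-map (false ∷_) (allF m)) (length-map (true ∷_) (allF m)) ⟩
  length (allF m) + length (allF m)
    ≡⟨ cong (λ n → n + n) (length-allF m) ⟩
  2 ^ m + 2 ^ m
    ≡⟨ cong (λ n → 2 ^ m + n) (+-identityʳ (2 ^ m)) ⟨
  2 ^ suc m ∎
  where open ≡-Reasoning

inGround : ∀ {m} → F m → F m → Bool
inGround α x = not (x == 0F) ∧ not (x == α)

T-inGround : ∀ {m} {α x : F m} → T (inGround α x) ⇔ (x ≢ 0F × x ≢ α)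
T-inGround {α = α} {x} = mk⇔
  (Product.map (toWitnessFalse {a? = x ≟ 0F}) (toWitnessFalse {a? = x ≟ α}) ∘ Equivalence.to T-∧)
  (Equivalence.from T-∧ ∘ Product.map (fromWitnessFalse {a? = x ≟ 0F}) (fromWitnessFalse {a? = x ≟ α}))

∈-ground : ∀ {m} {α y : F m} → y ∈ ground α ⇔ (y ≢ 0F × y ≢ α)
∈-ground {m} {α} = mk⇔
  (Equivalence.to T-inGround ∘ proj₂ ∘ ∈-filter⁻ (T? ∘ inGround α) {xs = allF m})
  (∈-filter⁺ (T? ∘ inGround α) (∈-allF _) ∘ Equivalence.from T-inGround)

ground-unique : ∀ {m} (α : F m) → Unique (ground α)
ground-unique {m} α = Unique.filter⁺ (T? ∘ inGround α) (allF-unique m)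

ground-⊕-closed : ∀ {m} {α y : F m} → y ∈ ground α → (y ⊕ α) ∈ ground α
ground-⊕-closed {α = α} {y} y∈G with y≢0 , y≢α ← Equivalence.to ∈-ground y∈G =
  Equivalence.from ∈-ground (y≢α ∘ y⊕α≡0⇒y≡α , y≢0 ∘ y⊕α≡α⇒y≡0)
  where
  y⊕α≡0⇒y≡α : y ⊕ α ≡ 0F → y ≡ α
  y⊕α≡0⇒y≡α eq = trans (sym (⊕-cancelʳ y α)) (trans (cong (_⊕ α) eq) (⊕-identityˡ α))
  y⊕α≡α⇒y≡0 : y ⊕ α ≡ α → y ≡ 0F
  y⊕α≡α⇒y≡0 eq = trans (sym (⊕-cancelʳ y α)) (trans (cong (_⊕ α) eq) (⊕-self α))

allF-↭ : ∀ {m} {α : F m} → α ≢ 0F → allF m ↭ 0F ∷ α ∷ ground α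
allF-↭ {m} {α} α≢0 with R , allF↭0αR ← ∈⇒↭∷∷ (∈-allF 0F) (∈-allF α) (α≢0 ∘ sym) =
  ↭.trans allF↭0αR (prep 0F (prep α (↭-sym ground↭R)))
  where
  P? = T? ∘ inGround α
  unique : Unique (0F ∷ α ∷ R)
  unique = Unique-resp-↭ allF↭0αR (allF-unique m)
  R⊆ground : ∀ {z} → z ∈ R → T (inGround α z)
  R⊆ground z∈R = Equivalence.from T-inGround
    ( (λ z≡0 → Unique.Unique[x∷xs]⇒x∉xs unique (there (subst (_∈ R) z≡0 z∈R)))
    , (λ z≡α → Unique.Unique[x∷xs]⇒x∉xs (Unique-tail unique) (subst (_∈ R) z≡α z∈R)))
  ground↭R : ground α ↭ R
  ground↭R = ↭.trans (filter-↭ P? allF↭0αR) (↭-reflexive (begin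
    filter P? (0F ∷ α ∷ R) ≡⟨ filter-reject P? {x = 0F} (λ t → proj₁ (Equivalence.to (T-inGround {α = α}) t) refl) ⟩
    filter P? (α ∷ R)      ≡⟨ filter-reject P? {x = α} (λ t → proj₂ (Equivalence.to (T-inGround {x = α}) t) refl) ⟩
    filter P? R            ≡⟨ filter-all P? (tabulate R⊆ground) ⟩
    R                      ∎))
    where open ≡-Reasoning

length-ground : ∀ {m} {α : F m} → α ≢ 0F → 2 + length (ground α) ≡ 2 ^ m
length-ground {m} α≢0 = trans (sym (↭-length (allF-↭ α≢0))) (length-allF m)

2+2n≡2^m⇒n≡2^[m∸1]∸1 : ∀ m n → 2 + 2 * n ≡ 2 ^ m → n ≡ 2 ^ (m ∸ 1) ∸ 1
2+2n≡2^m⇒n≡2^[m∸1]∸1 zero    n ()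
2+2n≡2^m⇒n≡2^[m∸1]∸1 (suc m) n eq = cong (_∸ 1) (*-cancelˡ-≡ (1 + n) (2 ^ m) 2 (trans (*-suc 2 n) eq))

imbalance-ground : ∀ {m} {α : F m} → α ≢ 0F →
  imbalance α (countSubsets (ground α)) ≗ [1-t²]^ (2 ^ (m ∸ 1) ∸ 1)
imbalance-ground {m} {α} α≢0 k
  with xs , ground↭pairs ←
         ↭-pairs (λ x → ⊕-cancelʳ x α) (λ _ → α≢0 ∘ x⊕y≡x⇒y≡0) (ground-unique α) ground-⊕-closed
  = begin
  imbalance α (countSubsets (ground α)) k
    ≡⟨ imbalance-cong α (countSubsets-↭ ground↭pairs) k ⟩
  imbalance α (countSubsets (pairs (_⊕ α) xs)) k
    ≡⟨ imbalance-pairs α≢0 xs k ⟩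
  [1-t²]^ (length xs) k
    ≡⟨ cong (λ N → [1-t²]^ N k) (2+2n≡2^m⇒n≡2^[m∸1]∸1 m (length xs) count) ⟩
  [1-t²]^ (2 ^ (m ∸ 1) ∸ 1) k ∎
  where
  open ≡-Reasoning
  count : 2 + 2 * length xs ≡ 2 ^ m
  count = begin
    2 + 2 * length xs               ≡⟨ cong (λ n → 2 + n) (length-pairs (_⊕ α) xs) ⟨
    2 + length (pairs (_⊕ α) xs)    ≡⟨ cong (λ n → 2 + n) (↭-length ground↭pairs) ⟨
    2 + length (ground α)           ≡⟨ length-ground α≢0 ⟩
    2 ^ m                           ∎

+m-+n≡-+o⇒n≡m+o : ∀ {m n o} → + m - + n ≡ - + o → n ≡ m + o
+m-+n≡-+o⇒n≡m+o {m} {n} {o} eq = ℤ.+-injective (begin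
  + n                  ≡⟨ j≡i-[i-j] (+ m) (+ n) ⟩
  + m - (+ m - + n)    ≡⟨ cong (λ i → + m - i) eq ⟩
  + m - - + o          ≡⟨ cong (λ i → + m +ℤ i) (ℤ.neg-involutive (+ o)) ⟩
  + m +ℤ + o           ≡⟨ ℤ.pos-+ m o ⟨
  + (m + o)            ∎)
  where
  open ≡-Reasoning
  j≡i-[i-j] : ∀ i j → j ≡ i - (i - j)
  j≡i-[i-j] = solve-∀

+m-+n≡+o⇒n+o≡m : ∀ {m n o} → + m - + n ≡ + o → n + o ≡ m
+m-+n≡+o⇒n+o≡m {m} {n} {o} eq = ℤ.+-injective (begin
  + (n + o)            ≡⟨ ℤ.pos-+ n o ⟩
  + n +ℤ + o           ≡⟨ cong (λ i → + n +ℤ i) eq ⟨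
  + n +ℤ (+ m - + n)   ≡⟨ j+[i-j]≡i (+ m) (+ n) ⟩
  + m                  ∎)
  where
  open ≡-Reasoning
  j+[i-j]≡i : ∀ i j → j +ℤ (i - j) ≡ i
  j+[i-j]≡i = solve-∀

-- The bounds on m and k only exclude degenerate cases; the identity holds as soon as α ≠ 0.
lemma2p8 : (m k : ℕ) (α : F m) → 3 ≤ m → 3 ≤ k → k ≤ 2 ^ m ∸ 4 → α ≢ 0F →
    ((k % 4 ≡ 1 ⊎ k % 4 ≡ 3) → cardI k α ≡ cardJ k α)
    × (k % 4 ≡ 2 → cardI k α ≡ cardJ k α + (2 ^ (m ∸ 1) ∸ 1) C (k / 2))
    × (k % 4 ≡ 0 → cardI k α + (2 ^ (m ∸ 1) ∸ 1) C (k / 2) ≡ cardJ k α)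
lemma2p8 m k α _ _ _ α≢0 =
  let odd , twoMod4 , zeroMod4 = [1-t²]^-mod4 N k in
    (λ k%4≡1∨3 → sym (ℤ.+-injective (ℤ.i-j≡0⇒i≡j _ _ (trans balance (odd k%4≡1∨3)))))
  , (λ k%4≡2 → +m-+n≡-+o⇒n≡m+o (trans balance (twoMod4 k%4≡2)))
  , (λ k%4≡0 → +m-+n≡+o⇒n+o≡m (trans balance (zeroMod4 k%4≡0)))
  where
  N = 2 ^ (m ∸ 1) ∸ 1
  balance : + cardJ k α - + cardI k α ≡ [1-t²]^ N k
  balance = imbalance-ground α≢0 k
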